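{- Let $r_1<r_2<\cdots$ be an increasing sequence of positive integers, and let $\sigma$ be a stable background on $\mathbb{Z}^d$ in which every site of $\mathcal{B}_{r_1}\cup\mathcal{B}_{r_2}\cup\cdots$ has at most $2d-2$ particles. Then $\sigma$ is robust.
   Context: Abelian sandpile on $\mathbb{Z}^d$: a configuration is a function $\eta:\mathbb{Z}^d\to\mathbb{Z}$; a site $x$ is unstable if $\eta(x)\ge2d$, and toppling it sends one particle to each of its $2d$ lattice neighbours; a configuration is stable if it is $\le 2d-1$ everywhere. $\delta_o$ is a single particle at the origin. Given a stable background $\sigma$ and $n\ge1$, enumerate the sites of $\mathbb{Z}^d$ and topple, at each discrete time step, the smallest unstable site of $\sigma+n\delta_o$ (if any); $T_n$ is the set of sites that ever topple. $\sigma$ is robust if $T_n$ is finite for every $n\ge1$. $Q_r=\{x\in\mathbb{Z}^d:\max_i|x_i|\le r\}$ and $\mathcal{B}_r=\partial Q_r=\{y\notin Q_r : y\text{ has a lattice neighbour in } Q_r\}$. -}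

module Defs where

open import Data.Nat as ℕ using (ℕ; zero; suc)
open import Data.Integer as ℤ using (ℤ; +_; ∣_∣)
open import Data.Fin using (Fin)
open import Data.Vec using (Vec; lookup; _[_]≔_; replicate)
open import Data.Vec.Properties using (≡-dec)
open import Data.Vec.Relation.Unary.All using (All)
open import Data.List using (List; []; _∷_; _++_; concatMap; allFin)
open import Data.List.Membership.Propositional using (_∈_)
open import Data.Product using (Σ; ∃; _×_; _,_)
open import Data.Sum using (_⊎_)
open import Relation.Nullary using (¬_; yes; no)
open import Relation.Binary.PropositionalEquality using (_≡_)
open import Function.Bundles using (_⤖_; Bijection)

Site : ℕ → Set
Site d = Vec ℤ d

origin : (d : ℕ) → Site d
origin d = replicate d (+ 0)

_≟S_ : ∀ {d} → (x y : Site d) → Relation.Nullary.Dec (x ≡ y)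
_≟S_ = ≡-dec ℤ._≟_

neighbours : ∀ {d} → Site d → List (Site d)
neighbours {d} x =
  concatMap (λ i → (x [ i ]≔ (lookup x i ℤ.+ + 1)) ∷ (x [ i ]≔ (lookup x i ℤ.- + 1)) ∷ []) (allFin d)

count : ∀ {d} → Site d → List (Site d) → ℕ
count y [] = 0
count y (z ∷ zs) with y ≟S z
... | yes _ = suc (count y zs)
... | no _  = count y zs

Config : ℕ → Set
Config d = Site d → ℤ

addAtOrigin : ∀ {d} → Config d → ℕ → Config d
addAtOrigin {d} σ n y with y ≟S origin d
... | yes _ = σ y ℤ.+ + n
... | no _  = σ y

topple : ∀ {d} → Site d → Config d → Config d
topple {d} x η y with y ≟S x
... | yes _ = η y ℤ.- + (2 ℕ.* d) ℤ.+ + count y (neighbours x)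
... | no _  = η y ℤ.+ + count y (neighbours x)

Unstable : ∀ {d} → Config d → Site d → Set
Unstable {d} η x = + (2 ℕ.* d) ℤ.≤ η x

Stable : ∀ {d} → Config d → Set
Stable {d} η = ∀ x → η x ℤ.≤ + (2 ℕ.* d) ℤ.- + 1

Enumeration : ℕ → Set
Enumeration d = Site d ⤖ ℕ

index : ∀ {d} → Enumeration d → Site d → ℕ
index e = Bijection.to e

SmallestUnstable : ∀ {d} → Enumeration d → Config d → Site d → Set
SmallestUnstable e η x = Unstable η x × (∀ y → Unstable η y → index e x ℕ.≤ index e y)

record Run {d : ℕ} (e : Enumeration d) (η₀ : Config d) : Set where
  field
    conf  : ℕ → Config d
    start : ∀ y → conf 0 y ≡ η₀ y
    step  : ∀ t →
      (Stable (conf t) × (∀ y → conf (suc t) y ≡ conf t y))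
      ⊎ (∃ λ x → SmallestUnstable e (conf t) x × (∀ y → conf (suc t) y ≡ topple x (conf t) y))

Topples : ∀ {d} {e : Enumeration d} {η₀ : Config d} → Run e η₀ → Site d → Set
Topples {e = e} R x = ∃ λ t → SmallestUnstable e (Run.conf R t) x

Robust : ∀ {d} → Enumeration d → Config d → Set
Robust {d} e σ = ∀ n → 1 ℕ.≤ n → (R : Run e (addAtOrigin σ n)) →
  Σ (List (Site d)) λ L → ∀ x → Topples R x → x ∈ L

InQ : ∀ {d} → ℕ → Site d → Set
InQ r x = All (λ c → ∣ c ∣ ℕ.≤ r) x

InB : ∀ {d} → ℕ → Site d → Set
InB r y = ¬ InQ r y × (∃ λ z → z ∈ neighbours y × InQ r z)

-- Least action principle: if u counts the topplings performed at each site during a run from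
-- η₀, the configuration reached is (at most) η₀ + Δu, with Δ the lattice Laplacian.  If
-- w : ℤ^d → ℕ makes η₀ + Δw stable, then u ≤ w at all times: a site with u = w carries at
-- most (η₀ + Δw) < 2d particles, so it is never the one that topples.  Hence every toppling
-- site lies in the support of w.  For η₀ = σ + nδₒ take the radial potential
-- w(x) = Σ_{k<n} (r_k + 1 − ‖x‖∞)⁺.  Along a maximal coordinate each tent has second difference
-- −2 at 0, +1 at its kink ‖x‖∞ = r_k + 1 and 0 elsewhere; so Δw ≤ −n at the origin and Δw ≤ 0
-- except on the boundaries B_{r_k}, where Δw ≤ 1 is absorbed by σ ≤ 2d − 2.  The support of w
-- is a finite cube.
module Submission where

open import Defs
open import Data.Nat as ℕ using (ℕ; zero; suc; _≤_; _<_; z≤n; s≤s; _∸_; _⊔_)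
import Data.Nat.Properties as NP
open import Data.Nat.ListAction using (sum)
open import Data.Nat.Tactic.RingSolver using (solve-∀)
open import Data.Integer as ℤ using (ℤ; +_; -[1+_]; ∣_∣; +≤+)
import Data.Integer.Properties as ZP
import Data.Integer.Tactic.RingSolver as ℤ-Solver
open import Data.Fin as Fin using (Fin; _≟_)
import Data.Fin.Properties as FP
open import Data.Vec using ([]; _∷_; lookup; _[_]≔_)
open import Data.Vec.Properties
  using (updateAt-updateAt-local; updateAt-id; lookup∘update; lookup∘update′; lookup-replicate)
open import Data.Vec.Relation.Unary.All using ([]; _∷_)
open import Data.Vec.Relation.Unary.All.Properties using (lookup⁺; lookup⁻)
open import Data.List using (List; []; _∷_; _++_; map; concatMap; allFin; upTo; length)
open import Data.List.Properties using (length-tabulate)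
import Data.List.Relation.Unary.All as List
open import Data.List.Relation.Unary.AllPairs using (_∷_)
open import Data.List.Relation.Unary.Any using (here; there)
open import Data.List.Relation.Unary.Unique.Propositional using (Unique)
open import Data.List.Relation.Unary.Unique.Propositional.Properties using (allFin⁺)
open import Data.List.Membership.Propositional using (_∈_; lose)
open import Data.List.Membership.Propositional.Properties
  using (∈-allFin; ∈-concatMap⁺; ∈-map⁺; ∈-++⁺ˡ; ∈-++⁺ʳ; ∈-upTo⁺)
open import Data.Product using (∃; _×_; _,_; proj₁; proj₂)
open import Data.Sum using (_⊎_; inj₁; inj₂)
open import Data.Empty using (⊥-elim)
open import Relation.Nullary using (¬_; yes; no)
open import Relation.Nullary.Decidable using (¬?; _×-dec_)
open import Function using (_∘_; id)
open import Relation.Binary.PropositionalEquality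
open import Algebra.Properties.CommutativeSemigroup NP.+-commutativeSemigroup
  using (x∙yz≈y∙xz; interchange)

infixl 6 _+ₑ_ _-ₑ_

_+ₑ_ _-ₑ_ : ∀ {d} → Site d → Fin d → Site d
x +ₑ i = x [ i ]≔ (lookup x i ℤ.+ + 1)
x -ₑ i = x [ i ]≔ (lookup x i ℤ.- + 1)

private
  update-inverse : ∀ {d} (f g : ℤ → ℤ) → (∀ a → g (f a) ≡ a) → (x : Site d) (i : Fin d) →
    let y = x [ i ]≔ f (lookup x i) in y [ i ]≔ g (lookup y i) ≡ x
  update-inverse f g g∘f x i =
    trans (updateAt-updateAt-local i x (trans (cong g (lookup∘update i x _)) (g∘f _)))
          (updateAt-id i x)

+ₑ-ₑ : ∀ {d} (x : Site d) i → x +ₑ i -ₑ i ≡ x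
+ₑ-ₑ = update-inverse (ℤ._+ + 1) (ℤ._- + 1) ℤ-Solver.solve-∀

-ₑ+ₑ : ∀ {d} (x : Site d) i → x -ₑ i +ₑ i ≡ x
-ₑ+ₑ = update-inverse (ℤ._- + 1) (ℤ._+ + 1) ℤ-Solver.solve-∀

δ : ∀ {d} → Site d → Site d → ℕ
δ x z with x ≟S z
... | yes _ = 1
... | no _  = 0

δ-self : ∀ {d} (x : Site d) → δ x x ≡ 1
δ-self x with x ≟S x
... | yes _   = refl
... | no x≢x = ⊥-elim (x≢x refl)

δ-other : ∀ {d} {x z : Site d} → x ≢ z → δ x z ≡ 0
δ-other {x = x} {z} x≢z with x ≟S z
... | yes x≡z = ⊥-elim (x≢z x≡z)
... | no _    = refl

δ-cong : ∀ {d} (x z x′ z′ : Site d) → (x ≡ z → x′ ≡ z′) → (x′ ≡ z′ → x ≡ z) → δ x z ≡ δ x′ z′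
δ-cong x z x′ z′ to from with x ≟S z | x′ ≟S z′
... | yes _   | yes _    = refl
... | no _    | no _     = refl
... | yes x≡z | no x′≢z′ = ⊥-elim (x′≢z′ (to x≡z))
... | no x≢z  | yes x′≡z′ = ⊥-elim (x≢z (from x′≡z′))

count-∷ : ∀ {d} (y z : Site d) zs → count y (z ∷ zs) ≡ δ y z ℕ.+ count y zs
count-∷ y z zs with y ≟S z
... | yes _ = refl
... | no _  = refl

sum-map-δ : ∀ {d} (x : Site d) zs → sum (map (δ x) zs) ≡ count x zs
sum-map-δ x []       = refl
sum-map-δ x (z ∷ zs) = trans (cong (δ x z ℕ.+_) (sum-map-δ x zs)) (sym (count-∷ x z zs))

count-neighbours-sym : ∀ {d} (x y : Site d) → count y (neighbours x) ≡ count x (neighbours y)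
count-neighbours-sym {d} x y = go (allFin d)
  where
  shifts : Site d → List (Fin d) → List (Site d)
  shifts z = concatMap (λ i → z +ₑ i ∷ z -ₑ i ∷ [])

  go : ∀ is → count y (shifts x is) ≡ count x (shifts y is)
  go []       = refl
  go (i ∷ is) = begin
    count y (x +ₑ i ∷ x -ₑ i ∷ shifts x is)
      ≡⟨ trans (count-∷ y _ _) (cong (δ y (x +ₑ i) ℕ.+_) (count-∷ y _ _)) ⟩
    δ y (x +ₑ i) ℕ.+ (δ y (x -ₑ i) ℕ.+ count y (shifts x is))
      ≡⟨ cong₂ ℕ._+_ (δ-cong y (x +ₑ i) x (y -ₑ i) (λ { refl → sym (+ₑ-ₑ x i) })
                                                       (λ { refl → sym (-ₑ+ₑ y i) }))
                     (cong₂ ℕ._+_ (δ-cong y (x -ₑ i) x (y +ₑ i) (λ { refl → sym (-ₑ+ₑ x i) })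
                                                                  (λ { refl → sym (+ₑ-ₑ y i) }))
                                  (go is)) ⟩
    δ x (y -ₑ i) ℕ.+ (δ x (y +ₑ i) ℕ.+ count x (shifts y is))
      ≡⟨ x∙yz≈y∙xz (δ x (y -ₑ i)) (δ x (y +ₑ i)) (count x (shifts y is)) ⟩
    δ x (y +ₑ i) ℕ.+ (δ x (y -ₑ i) ℕ.+ count x (shifts y is))
      ≡⟨ sym (trans (count-∷ x _ _) (cong (δ x (y +ₑ i) ℕ.+_) (count-∷ x _ _))) ⟩
    count x (y +ₑ i ∷ y -ₑ i ∷ shifts y is) ∎
    where open ≡-Reasoning

-- The lattice Laplacian and the least action principle

Δ : ∀ {d} → (Site d → ℕ) → Config d
Δ {d} u y = + sum (map u (neighbours y)) ℤ.- + (2 ℕ.* d ℕ.* u y)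

sum-map-mono : ∀ {A : Set} {u v : A → ℕ} → (∀ a → u a ≤ v a) → ∀ as → sum (map u as) ≤ sum (map v as)
sum-map-mono u≤v []       = z≤n
sum-map-mono u≤v (a ∷ as) = NP.+-mono-≤ (u≤v a) (sum-map-mono u≤v as)

sum-map-+ : ∀ {A : Set} (u v : A → ℕ) as →
  sum (map (λ a → u a ℕ.+ v a) as) ≡ sum (map u as) ℕ.+ sum (map v as)
sum-map-+ u v []       = refl
sum-map-+ u v (a ∷ as) = trans (cong (u a ℕ.+ v a ℕ.+_) (sum-map-+ u v as))
                               (interchange (u a) (v a) (sum (map u as)) (sum (map v as)))

sum-map-zero : ∀ {A : Set} (as : List A) → sum (map (λ _ → 0) as) ≡ 0
sum-map-zero []       = refl
sum-map-zero (a ∷ as) = sum-map-zero as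

sum-map-≤ : ∀ {A : Set} (p : A → ℕ) {W} {as : List A} → List.All (λ a → p a ≤ W) as →
  sum (map p as) ≤ length as ℕ.* W
sum-map-≤ p List.[]         = z≤n
sum-map-≤ p (pa≤ List.∷ ps) = NP.+-mono-≤ pa≤ (sum-map-≤ p ps)

sum-map-≤-except : ∀ {A : Set} (p : A → ℕ) {W c j} {as : List A} → Unique as → j ∈ as →
  (∀ i → i ≢ j → p i ≤ W) → p j ≤ c ℕ.+ W → sum (map p as) ≤ c ℕ.+ length as ℕ.* W
sum-map-≤-except p {W} {c} {as = j ∷ as} (j∉as ∷ _) (here refl) others pj =
  NP.≤-trans (NP.+-mono-≤ pj (sum-map-≤ p (List.map (λ j≢i → others _ (j≢i ∘ sym)) j∉as)))
             (NP.≤-reflexive (NP.+-assoc c W (length as ℕ.* W)))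
sum-map-≤-except p {W} {c} {as = i ∷ as} (i∉as ∷ unique) (there j∈as) others pj =
  NP.≤-trans (NP.+-mono-≤ (others i (List.lookup i∉as j∈as)) (sum-map-≤-except p unique j∈as others pj))
             (NP.≤-reflexive (x∙yz≈y∙xz W c (length as ℕ.* W)))

Δ-zero : ∀ {d} (y : Site d) → Δ (λ _ → 0) y ≡ + 0
Δ-zero {d} y rewrite sum-map-zero (neighbours y) | NP.*-zeroʳ (2 ℕ.* d) = refl

Δ-+ : ∀ {d} (u v : Site d → ℕ) y → Δ (λ z → u z ℕ.+ v z) y ≡ Δ u y ℤ.+ Δ v y
Δ-+ {d} u v y
  rewrite sum-map-+ u v (neighbours y) | NP.*-distribˡ-+ (2 ℕ.* d) (u y) (v y)
        | ZP.pos-+ (sum (map u (neighbours y))) (sum (map v (neighbours y)))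
        | ZP.pos-+ (2 ℕ.* d ℕ.* u y) (2 ℕ.* d ℕ.* v y)
  = regroup (+ sum (map u (neighbours y))) (+ sum (map v (neighbours y)))
            (+ (2 ℕ.* d ℕ.* u y)) (+ (2 ℕ.* d ℕ.* v y))
  where
  regroup : ∀ a b c e → (a ℤ.+ b) ℤ.- (c ℤ.+ e) ≡ (a ℤ.- c) ℤ.+ (b ℤ.- e)
  regroup = ℤ-Solver.solve-∀

Δ-mono-at : ∀ {d} {u v : Site d → ℕ} → (∀ z → u z ≤ v z) → ∀ {y} → u y ≡ v y → Δ u y ℤ.≤ Δ v y
Δ-mono-at {d} {u} {v} u≤v {y} uy≡vy = begin
  Δ u y                  ≤⟨ ZP.+-monoˡ-≤ (ℤ.- + (2 ℕ.* d ℕ.* u y)) (+≤+ (sum-map-mono u≤v (neighbours y))) ⟩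
  + Sᵥ ℤ.- + (2 ℕ.* d ℕ.* u y)  ≡⟨ cong (λ a → + Sᵥ ℤ.- + (2 ℕ.* d ℕ.* a)) uy≡vy ⟩
  Δ v y                  ∎
  where
  open ZP.≤-Reasoning
  Sᵥ = sum (map v (neighbours y))

topple≡+Δδ : ∀ {d} (x : Site d) (η : Config d) y → topple x η y ≡ η y ℤ.+ Δ (δ x) y
topple≡+Δδ {d} x η y
  rewrite sum-map-δ x (neighbours y) | sym (count-neighbours-sym x y) with y ≟S x
... | yes refl rewrite δ-self y | NP.*-identityʳ (2 ℕ.* d) =
  reorder (η y) (+ (2 ℕ.* d)) (+ count y (neighbours y))
  where
  reorder : ∀ a b c → a ℤ.- b ℤ.+ c ≡ a ℤ.+ (c ℤ.- b)
  reorder = ℤ-Solver.solve-∀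
... | no y≢x rewrite δ-other (λ x≡y → y≢x (sym x≡y)) | NP.*-zeroʳ (2 ℕ.* d) =
  cong (λ a → η y ℤ.+ + a) (sym (NP.+-identityʳ _))

module LeastAction {d} {e : Enumeration d} {η₀ : Config d} (R : Run e η₀)
                   (w : Site d → ℕ) (w-stabilises : Stable (λ y → η₀ y ℤ.+ Δ w y)) where
  open Run R

  -- The actual odometer u of the first t steps satisfies conf t = η₀ + Δ u; ≤ suffices.
  BoundedOdometer : ℕ → (Site d → ℕ) → Set
  BoundedOdometer t u = (∀ z → u z ≤ w z) × (∀ y → conf t y ℤ.≤ η₀ y ℤ.+ Δ u y)

  odometer-<-at-unstable : ∀ {t u} → BoundedOdometer t u → ∀ {y} → Unstable (conf t) y → u y < w y
  odometer-<-at-unstable {t} {u} (u≤w , conf≤) {y} unstable = NP.≰⇒> λ w≤u →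
    ZP.<-irrefl refl (ZP.≤-<-trans (ZP.≤-trans unstable (conf≤y w≤u)) (ZP.m⊖1+n<m (2 ℕ.* d) 1))
    where
    conf≤y : w y ≤ u y → conf t y ℤ.≤ + (2 ℕ.* d) ℤ.- + 1
    conf≤y w≤u = begin
      conf t y          ≤⟨ conf≤ y ⟩
      η₀ y ℤ.+ Δ u y    ≤⟨ ZP.+-monoʳ-≤ (η₀ y) (Δ-mono-at u≤w (NP.≤-antisym (u≤w y) w≤u)) ⟩
      η₀ y ℤ.+ Δ w y    ≤⟨ w-stabilises y ⟩
      + (2 ℕ.* d) ℤ.- + 1 ∎
      where open ZP.≤-Reasoning hiding (start)

  odometer : ∀ t → ∃ (BoundedOdometer t)
  odometer zero = (λ _ → 0) , (λ _ → z≤n) , λ y → begin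
    conf 0 y                   ≡⟨ start y ⟩
    η₀ y                       ≡⟨ sym (ZP.+-identityʳ (η₀ y)) ⟩
    η₀ y ℤ.+ + 0               ≡⟨ cong (λ a → η₀ y ℤ.+ a) (sym (Δ-zero y)) ⟩
    η₀ y ℤ.+ Δ (λ _ → 0) y     ∎
    where open ZP.≤-Reasoning hiding (start)
  odometer (suc t) with odometer t | step t
  ... | u , bounded | inj₁ (_ , unchanged) =
    u , proj₁ bounded , λ y → subst (ℤ._≤ η₀ y ℤ.+ Δ u y) (sym (unchanged y)) (proj₂ bounded y)
  ... | u , bounded | inj₂ (x , (x-unstable , _) , toppled) = u′ , u′≤w , λ y → begin
    conf (suc t) y                       ≡⟨ toppled y ⟩
    topple x (conf t) y                  ≡⟨ topple≡+Δδ x (conf t) y ⟩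
    conf t y ℤ.+ Δ (δ x) y               ≤⟨ ZP.+-monoˡ-≤ (Δ (δ x) y) (proj₂ bounded y) ⟩
    η₀ y ℤ.+ Δ u y ℤ.+ Δ (δ x) y         ≡⟨ ZP.+-assoc (η₀ y) (Δ u y) (Δ (δ x) y) ⟩
    η₀ y ℤ.+ (Δ u y ℤ.+ Δ (δ x) y)       ≡⟨ cong (λ a → η₀ y ℤ.+ a) (sym (Δ-+ u (δ x) y)) ⟩
    η₀ y ℤ.+ Δ u′ y                      ∎
    where
    open ZP.≤-Reasoning hiding (start)
    u′ : Site d → ℕ
    u′ z = u z ℕ.+ δ x z
    u′≤w : ∀ z → u′ z ≤ w z
    u′≤w z with x ≟S z
    ... | yes refl = subst (_≤ w x) (NP.+-comm 1 (u x)) (odometer-<-at-unstable bounded x-unstable)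
    ... | no _     = subst (_≤ w z) (sym (NP.+-identityʳ (u z))) (proj₁ bounded z)

  topples⇒0<w : ∀ {x} → Topples R x → 0 < w x
  topples⇒0<w (t , unstable , _) with odometer t
  ... | u , bounded = NP.≤-<-trans z≤n (odometer-<-at-unstable bounded unstable)

-- The sup norm and radial functions

‖_‖ : ∀ {d} → Site d → ℕ
‖ [] ‖    = 0
‖ c ∷ x ‖ = ∣ c ∣ ⊔ ‖ x ‖

∣lookup∣≤‖‖ : ∀ {d} (x : Site d) i → ∣ lookup x i ∣ ≤ ‖ x ‖
∣lookup∣≤‖‖ (c ∷ x) Fin.zero    = NP.m≤m⊔n ∣ c ∣ ‖ x ‖
∣lookup∣≤‖‖ (c ∷ x) (Fin.suc i) = NP.≤-trans (∣lookup∣≤‖‖ x i) (NP.m≤n⊔m ∣ c ∣ ‖ x ‖)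

‖‖-attained : ∀ {d} (x : Site (suc d)) → ∃ λ j → ‖ x ‖ ≡ ∣ lookup x j ∣
‖‖-attained (c ∷ [])     = Fin.zero , NP.⊔-identityʳ ∣ c ∣
‖‖-attained (c ∷ c′ ∷ x) with ∣ c ∣ ℕ.≤? ‖ c′ ∷ x ‖ | ‖‖-attained (c′ ∷ x)
... | yes c≤ | j , attained = Fin.suc j , trans (NP.m≤n⇒m⊔n≡n c≤) attained
... | no c≰  | _           = Fin.zero , NP.m≥n⇒m⊔n≡m (NP.≰⇒≥ c≰)

‖origin‖≡0 : ∀ d → ‖ origin d ‖ ≡ 0
‖origin‖≡0 zero    = refl
‖origin‖≡0 (suc d) = ‖origin‖≡0 d

‖‖≤⇒InQ : ∀ {d r} (x : Site d) → ‖ x ‖ ≤ r → InQ r x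
‖‖≤⇒InQ x ‖x‖≤r = lookup⁻ λ i → NP.≤-trans (∣lookup∣≤‖‖ x i) ‖x‖≤r

∣±1∣ : ∀ t {m} → ∣ t ∣ ≡ suc m →
  (∣ t ℤ.+ + 1 ∣ ≡ 2 ℕ.+ m × ∣ t ℤ.- + 1 ∣ ≡ m) ⊎ (∣ t ℤ.+ + 1 ∣ ≡ m × ∣ t ℤ.- + 1 ∣ ≡ 2 ℕ.+ m)
∣±1∣ (+ suc m)  refl = inj₁ (NP.+-comm (suc m) 1 , refl)
∣±1∣ -[1+ zero ] refl = inj₂ (refl , refl)
∣±1∣ -[1+ suc m ] refl = inj₂ (refl , cong (λ a → 2 ℕ.+ a) (NP.+-identityʳ (suc m)))

module Radial (f : ℕ → ℕ) (f-antitone : ∀ {m n} → m ≤ n → f n ≤ f m) {d : ℕ} where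

  w : Site d → ℕ
  w x = f ‖ x ‖

  pairSum : Site d → Fin d → ℕ
  pairSum x i = w (x +ₑ i) ℕ.+ w (x -ₑ i)

  sum-neighbours≡sum-pairSum : ∀ x → sum (map w (neighbours x)) ≡ sum (map (pairSum x) (allFin d))
  sum-neighbours≡sum-pairSum x = go (allFin d)
    where
    go : ∀ is → sum (map w (concatMap (λ i → x +ₑ i ∷ x -ₑ i ∷ []) is)) ≡ sum (map (pairSum x) is)
    go []       = refl
    go (i ∷ is) = trans (cong (λ a → w (x +ₑ i) ℕ.+ (w (x -ₑ i) ℕ.+ a)) (go is))
                        (sym (NP.+-assoc (w (x +ₑ i)) (w (x -ₑ i)) _))

  w≤f∣lookup∣ : ∀ z i → w z ≤ f ∣ lookup z i ∣
  w≤f∣lookup∣ z i = f-antitone (∣lookup∣≤‖‖ z i)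

  pairSum-≤-other : ∀ x {i j} → i ≢ j → pairSum x i ≤ 2 ℕ.* f ∣ lookup x j ∣
  pairSum-≤-other x {i} {j} i≢j =
    NP.+-mono-≤ (unmoved _) (NP.≤-trans (unmoved _) (NP.≤-reflexive (sym (NP.+-identityʳ _))))
    where
    unmoved : ∀ c → w (x [ i ]≔ c) ≤ f ∣ lookup x j ∣
    unmoved c = subst (λ a → w (x [ i ]≔ c) ≤ f ∣ a ∣) (lookup∘update′ (λ j≡i → i≢j (sym j≡i)) x c)
                      (w≤f∣lookup∣ (x [ i ]≔ c) j)

  pairSum-≤-self : ∀ x i → pairSum x i ≤ f ∣ lookup x i ℤ.+ + 1 ∣ ℕ.+ f ∣ lookup x i ℤ.- + 1 ∣
  pairSum-≤-self x i = NP.+-mono-≤ (moved _) (moved _)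
    where
    moved : ∀ c → w (x [ i ]≔ c) ≤ f ∣ c ∣
    moved c = subst (λ a → w (x [ i ]≔ c) ≤ f ∣ a ∣) (lookup∘update i x c) (w≤f∣lookup∣ (x [ i ]≔ c) i)

  pairSum-≤-at-0 : ∀ x i → lookup x i ≡ + 0 → pairSum x i ≤ 2 ℕ.* f 1
  pairSum-≤-at-0 x i xᵢ≡0 = NP.≤-trans
    (subst (λ a → pairSum x i ≤ f ∣ a ℤ.+ + 1 ∣ ℕ.+ f ∣ a ℤ.- + 1 ∣) xᵢ≡0 (pairSum-≤-self x i))
    (NP.≤-reflexive (cong (f 1 ℕ.+_) (sym (NP.+-identityʳ (f 1)))))

  pairSum-≤-at-suc : ∀ x i {m} → ∣ lookup x i ∣ ≡ suc m → pairSum x i ≤ f (2 ℕ.+ m) ℕ.+ f m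
  pairSum-≤-at-suc x i {m} ∣xᵢ∣≡ with ∣±1∣ (lookup x i) ∣xᵢ∣≡
  ... | inj₁ (out , in′) =
    subst (pairSum x i ≤_) (cong₂ (λ a b → f a ℕ.+ f b) out in′) (pairSum-≤-self x i)
  ... | inj₂ (in′ , out) =
    subst (pairSum x i ≤_) (trans (cong₂ (λ a b → f a ℕ.+ f b) in′ out) (NP.+-comm (f m) _))
          (pairSum-≤-self x i)

  neighbourSum-≤ : ∀ x j c → ‖ x ‖ ≡ ∣ lookup x j ∣ → pairSum x j ≤ c ℕ.+ 2 ℕ.* w x →
    sum (map w (neighbours x)) ≤ c ℕ.+ 2 ℕ.* d ℕ.* w x
  neighbourSum-≤ x j c attained pairSumⱼ≤ = begin
    sum (map w (neighbours x))
      ≡⟨ sum-neighbours≡sum-pairSum x ⟩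
    sum (map (pairSum x) (allFin d))
      ≤⟨ sum-map-≤-except (pairSum x) (allFin⁺ d) (∈-allFin j) others pairSumⱼ≤ ⟩
    c ℕ.+ length (allFin d) ℕ.* (2 ℕ.* w x)
      ≡⟨ cong (λ a → c ℕ.+ a ℕ.* (2 ℕ.* w x)) (length-tabulate {n = d} id) ⟩
    c ℕ.+ d ℕ.* (2 ℕ.* w x)
      ≡⟨ cong (c ℕ.+_) (*-rearrange d (w x)) ⟩
    c ℕ.+ 2 ℕ.* d ℕ.* w x
      ∎
    where
    open NP.≤-Reasoning
    others : ∀ i → i ≢ j → pairSum x i ≤ 2 ℕ.* w x
    others i i≢j = subst (λ a → pairSum x i ≤ 2 ℕ.* f a) (sym attained) (pairSum-≤-other x i≢j)
    *-rearrange : ∀ a b → a ℕ.* (2 ℕ.* b) ≡ 2 ℕ.* a ℕ.* b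
    *-rearrange = solve-∀

-- Tents and their second differences

tent : ℕ → ℕ → ℕ
tent R m = suc R ∸ m

SecondDifference : (ℕ → ℕ) → ℕ → ℕ → Set
SecondDifference g m c = g (2 ℕ.+ m) ℕ.+ g m ≡ c ℕ.+ 2 ℕ.* g (1 ℕ.+ m)

tent-flat : ∀ R m → R ≢ m → SecondDifference (tent R) m 0
tent-flat zero    zero    0≢0 = ⊥-elim (0≢0 refl)
tent-flat zero    (suc m) _   = NP.0∸n≡0 m
tent-flat (suc R) zero    _   = rearrange R
  where
  rearrange : ∀ a → a ℕ.+ suc (suc a) ≡ 2 ℕ.* suc a
  rearrange = solve-∀
tent-flat (suc R) (suc m) R≢m = tent-flat R m (R≢m ∘ cong suc)

tent-kink : ∀ R → SecondDifference (tent R) R 1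
tent-kink zero    = refl
tent-kink (suc R) = tent-kink R

SecondDifference-+ : ∀ g h {m} c c′ → SecondDifference g m c → SecondDifference h m c′ →
  SecondDifference (λ k → g k ℕ.+ h k) m (c ℕ.+ c′)
SecondDifference-+ g h {m} c c′ g-eq h-eq = begin
  (g (2 ℕ.+ m) ℕ.+ h (2 ℕ.+ m)) ℕ.+ (g m ℕ.+ h m)
    ≡⟨ interchange (g (2 ℕ.+ m)) (h (2 ℕ.+ m)) (g m) (h m) ⟩
  (g (2 ℕ.+ m) ℕ.+ g m) ℕ.+ (h (2 ℕ.+ m) ℕ.+ h m)        ≡⟨ cong₂ ℕ._+_ g-eq h-eq ⟩
  (c ℕ.+ 2 ℕ.* g (1 ℕ.+ m)) ℕ.+ (c′ ℕ.+ 2 ℕ.* h (1 ℕ.+ m)) ≡⟨ regroup c c′ (g (1 ℕ.+ m)) (h (1 ℕ.+ m)) ⟩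
  (c ℕ.+ c′) ℕ.+ 2 ℕ.* (g (1 ℕ.+ m) ℕ.+ h (1 ℕ.+ m))     ∎
  where
  open ≡-Reasoning
  regroup : ∀ c c′ a b → (c ℕ.+ 2 ℕ.* a) ℕ.+ (c′ ℕ.+ 2 ℕ.* b) ≡ (c ℕ.+ c′) ℕ.+ 2 ℕ.* (a ℕ.+ b)
  regroup = solve-∀

module Potential (r : ℕ → ℕ) where

  P : ℕ → ℕ → ℕ
  P zero    m = 0
  P (suc n) m = tent (r n) m ℕ.+ P n m

  P-antitone : ∀ n {m m′} → m ≤ m′ → P n m′ ≤ P n m
  P-antitone zero    _     = z≤n
  P-antitone (suc n) m≤m′ = NP.+-mono-≤ (NP.∸-monoʳ-≤ (suc (r n)) m≤m′) (P-antitone n m≤m′)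

  P-at-0 : ∀ n → P n 0 ≡ n ℕ.+ P n 1
  P-at-0 zero    = refl
  P-at-0 (suc n) = cong suc (trans (cong (r n ℕ.+_) (P-at-0 n)) (x∙yz≈y∙xz (r n) n (P n 1)))

  0<P⇒<P0 : ∀ n m → 0 < P n m → m < P n 0
  0<P⇒<P0 (suc n) m 0<P with m ℕ.≤? r n
  ... | yes m≤rₙ = NP.≤-trans (s≤s m≤rₙ) (NP.m≤m+n (suc (r n)) (P n 0))
  ... | no m≰rₙ  = NP.≤-trans
    (0<P⇒<P0 n m (subst (0 <_) (cong (ℕ._+ P n m) (NP.m≤n⇒m∸n≡0 (NP.≰⇒> m≰rₙ))) 0<P))
    (NP.m≤n+m (P n 0) (suc (r n)))

  P-flat : ∀ n m → (∀ k → k < n → r k ≢ m) → SecondDifference (P n) m 0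
  P-flat zero    m _     = refl
  P-flat (suc n) m avoid = SecondDifference-+ (tent (r n)) (P n) 0 0
    (tent-flat (r n) m (avoid n NP.≤-refl)) (P-flat n m (λ k k<n → avoid k (NP.m<n⇒m<1+n k<n)))

  module _ (r-increasing : ∀ k → r k < r (suc k)) where

    r-mono : ∀ {k j} → k < j → r k < r j
    r-mono {k} {suc j} k<1+j with NP.m≤n⇒m<n∨m≡n (NP.≤-pred k<1+j)
    ... | inj₁ k<j  = NP.<-trans (r-mono k<j) (r-increasing j)
    ... | inj₂ refl = r-increasing k

    P-second-difference : ∀ n m →
      SecondDifference (P n) m 0 ⊎ ∃ λ k → r k ≡ m × SecondDifference (P n) m 1
    P-second-difference zero    m = inj₁ refl
    P-second-difference (suc n) m with r n ℕ.≟ m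
    ... | yes refl = inj₂ (n , refl , SecondDifference-+ (tent (r n)) (P n) 1 0 (tent-kink (r n))
                                        (P-flat n (r n) (λ k k<n → NP.<⇒≢ (r-mono k<n))))
    ... | no rₙ≢m with P-second-difference n m
    ...   | inj₁ flat =
      inj₁ (SecondDifference-+ (tent (r n)) (P n) 0 0 (tent-flat (r n) m rₙ≢m) flat)
    ...   | inj₂ (k , rₖ≡m , kink) =
      inj₂ (k , rₖ≡m , SecondDifference-+ (tent (r n)) (P n) 0 1 (tent-flat (r n) m rₙ≢m) kink)

+ₑ∈neighbours : ∀ {d} (x : Site d) i → x +ₑ i ∈ neighbours x
+ₑ∈neighbours x i = ∈-concatMap⁺ (λ k → x +ₑ k ∷ x -ₑ k ∷ []) (lose (∈-allFin i) (here refl))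

-ₑ∈neighbours : ∀ {d} (x : Site d) i → x -ₑ i ∈ neighbours x
-ₑ∈neighbours x i = ∈-concatMap⁺ (λ k → x +ₑ k ∷ x -ₑ k ∷ []) (lose (∈-allFin i) (there (here refl)))

inward-neighbour : ∀ {d} (x : Site d) j {R} → ∣ lookup x j ∣ ≡ suc R →
  ∃ λ z → z ∈ neighbours x × ∣ lookup z j ∣ ≡ R × (∀ i → i ≢ j → lookup z i ≡ lookup x i)
inward-neighbour x j ∣xⱼ∣≡ with ∣±1∣ (lookup x j) ∣xⱼ∣≡
... | inj₁ (_ , inward) = x -ₑ j , -ₑ∈neighbours x j , trans (cong ∣_∣ (lookup∘update j x _)) inward ,
                          λ i i≢j → lookup∘update′ i≢j x _
... | inj₂ (inward , _) = x +ₑ j , +ₑ∈neighbours x j , trans (cong ∣_∣ (lookup∘update j x _)) inward ,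
                          λ i i≢j → lookup∘update′ i≢j x _

InB-intro : ∀ {d} (x : Site d) j {R} → ∣ lookup x j ∣ ≡ suc R →
  (∀ i → i ≢ j → ∣ lookup x i ∣ ≤ R) → InB R x
InB-intro x j {R} ∣xⱼ∣≡ others with inward-neighbour x j ∣xⱼ∣≡
... | z , z∈neighbours , ∣zⱼ∣≡ , unmoved = outside , z , z∈neighbours , lookup⁻ inside
  where
  outside : ¬ InQ R x
  outside x∈Q = NP.1+n≰n (subst (_≤ R) ∣xⱼ∣≡ (lookup⁺ x∈Q j))
  inside : ∀ i → ∣ lookup z i ∣ ≤ R
  inside i with i ≟ j
  ... | yes refl = NP.≤-reflexive ∣zⱼ∣≡
  ... | no i≢j   = subst (λ a → ∣ a ∣ ≤ R) (sym (unmoved i i≢j)) (others i i≢j)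

others-≤-or-> : ∀ {d} (x : Site d) j m →
  (∀ i → i ≢ j → ∣ lookup x i ∣ ≤ m) ⊎ ∃ λ i → i ≢ j × m < ∣ lookup x i ∣
others-≤-or-> x j m with FP.any? (λ i → ¬? (i ≟ j) ×-dec (m ℕ.<? ∣ lookup x i ∣))
... | yes (i , i≢j , m<) = inj₂ (i , i≢j , m<)
... | no none            = inj₁ λ i i≢j → NP.≮⇒≥ (λ m< → none (i , i≢j , m<))

-- The Laplacian of the radial potential

module PotentialLaplacian (r : ℕ → ℕ) (r-increasing : ∀ k → r k < r (suc k)) (n d : ℕ) where
  open Potential r
  open Radial (P n) (P-antitone n) {suc d}

  laplacian-at-origin :
    sum (map w (neighbours (origin (suc d)))) ℕ.+ n ≤ 2 ℕ.* suc d ℕ.* w (origin (suc d))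
  laplacian-at-origin = begin
    sum (map w (neighbours o)) ℕ.+ n
      ≡⟨ cong (ℕ._+ n) (sum-neighbours≡sum-pairSum o) ⟩
    sum (map (pairSum o) (allFin (suc d))) ℕ.+ n
      ≤⟨ NP.+-monoˡ-≤ n (sum-map-≤ (pairSum o) (List.universal pairSumₒ≤ (allFin (suc d)))) ⟩
    length (allFin (suc d)) ℕ.* (2 ℕ.* P n 1) ℕ.+ n
      ≡⟨ cong (λ a → a ℕ.* (2 ℕ.* P n 1) ℕ.+ n) (length-tabulate {n = suc d} id) ⟩
    suc d ℕ.* (2 ℕ.* P n 1) ℕ.+ n
      ≤⟨ NP.+-monoʳ-≤ (suc d ℕ.* (2 ℕ.* P n 1)) (NP.m≤n*m n (2 ℕ.* suc d)) ⟩
    suc d ℕ.* (2 ℕ.* P n 1) ℕ.+ 2 ℕ.* suc d ℕ.* n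
      ≡⟨ regroup (suc d) (P n 1) n ⟩
    2 ℕ.* suc d ℕ.* (n ℕ.+ P n 1)
      ≡⟨ cong (2 ℕ.* suc d ℕ.*_) (sym (P-at-0 n)) ⟩
    2 ℕ.* suc d ℕ.* P n 0
      ≡⟨ cong (λ a → 2 ℕ.* suc d ℕ.* P n a) (sym (‖origin‖≡0 (suc d))) ⟩
    2 ℕ.* suc d ℕ.* w o
      ∎
    where
    open NP.≤-Reasoning
    o = origin (suc d)
    pairSumₒ≤ : ∀ i → pairSum o i ≤ 2 ℕ.* P n 1
    pairSumₒ≤ i = pairSum-≤-at-0 o i (lookup-replicate i (+ 0))
    regroup : ∀ a b c → a ℕ.* (2 ℕ.* b) ℕ.+ 2 ℕ.* a ℕ.* c ≡ 2 ℕ.* a ℕ.* (c ℕ.+ b)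
    regroup = solve-∀

  laplacian-bound : ∀ x →
    sum (map w (neighbours x)) ≤ 2 ℕ.* suc d ℕ.* w x ⊎
    ∃ λ k → InB (r k) x × sum (map w (neighbours x)) ≤ 1 ℕ.+ 2 ℕ.* suc d ℕ.* w x
  laplacian-bound x with ‖‖-attained x
  ... | j , attained = by-coordinate ∣ lookup x j ∣ refl
    where
    open NP.≤-Reasoning

    from-pairSum : ∀ c → pairSum x j ≤ c ℕ.+ 2 ℕ.* w x →
      sum (map w (neighbours x)) ≤ c ℕ.+ 2 ℕ.* suc d ℕ.* w x
    from-pairSum c = neighbourSum-≤ x j c attained

    w≡ : ∀ {m} → ∣ lookup x j ∣ ≡ m → w x ≡ P n m
    w≡ ∣xⱼ∣≡ = cong (P n) (trans attained ∣xⱼ∣≡)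

    by-coordinate : ∀ m → ∣ lookup x j ∣ ≡ m →
      sum (map w (neighbours x)) ≤ 2 ℕ.* suc d ℕ.* w x ⊎
      ∃ λ k → InB (r k) x × sum (map w (neighbours x)) ≤ 1 ℕ.+ 2 ℕ.* suc d ℕ.* w x
    by-coordinate zero ∣xⱼ∣≡0 = inj₁ (from-pairSum 0 (begin
      pairSum x j    ≤⟨ pairSum-≤-at-0 x j (ZP.∣i∣≡0⇒i≡0 ∣xⱼ∣≡0) ⟩
      2 ℕ.* P n 1    ≤⟨ NP.*-monoʳ-≤ 2 (P-antitone n z≤n) ⟩
      2 ℕ.* P n 0    ≡⟨ cong (2 ℕ.*_) (sym (w≡ ∣xⱼ∣≡0)) ⟩
      2 ℕ.* w x      ∎))
    by-coordinate (suc m) ∣xⱼ∣≡ with P-second-difference r-increasing n m | others-≤-or-> x j m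
    ... | inj₁ flat | _ = inj₁ (from-pairSum 0 (begin
      pairSum x j                     ≤⟨ pairSum-≤-at-suc x j ∣xⱼ∣≡ ⟩
      P n (2 ℕ.+ m) ℕ.+ P n m         ≡⟨ flat ⟩
      2 ℕ.* P n (suc m)               ≡⟨ cong (2 ℕ.*_) (sym (w≡ ∣xⱼ∣≡)) ⟩
      2 ℕ.* w x                       ∎))
    ... | inj₂ (k , rₖ≡m , kink) | inj₁ others≤m = inj₂ (k , x∈B , from-pairSum 1 (begin
      pairSum x j                     ≤⟨ pairSum-≤-at-suc x j ∣xⱼ∣≡ ⟩
      P n (2 ℕ.+ m) ℕ.+ P n m         ≡⟨ kink ⟩
      1 ℕ.+ 2 ℕ.* P n (suc m)         ≡⟨ cong (λ a → 1 ℕ.+ 2 ℕ.* a) (sym (w≡ ∣xⱼ∣≡)) ⟩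
      1 ℕ.+ 2 ℕ.* w x                 ∎))
      where
      x∈B : InB (r k) x
      x∈B = InB-intro x j (trans ∣xⱼ∣≡ (cong suc (sym rₖ≡m)))
                      (λ i i≢j → subst (∣ lookup x i ∣ ≤_) (sym rₖ≡m) (others≤m i i≢j))
    ... | inj₂ _ | inj₂ (i , i≢j , m<∣xᵢ∣) = inj₁ (from-pairSum 0 (begin
      pairSum x j                     ≤⟨ pairSum-≤-other x (i≢j ∘ sym) ⟩
      2 ℕ.* P n ∣ lookup x i ∣        ≤⟨ NP.*-monoʳ-≤ 2 (P-antitone n m<∣xᵢ∣) ⟩
      2 ℕ.* P n (suc m)               ≡⟨ cong (2 ℕ.*_) (sym (w≡ ∣xⱼ∣≡)) ⟩
      2 ℕ.* w x                       ∎))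

+-difference-≤ : ∀ (s : ℤ) {K} c {S W} → s ℤ.+ + c ℤ.≤ K → S ≤ c ℕ.+ W → s ℤ.+ (+ S ℤ.- + W) ℤ.≤ K
+-difference-≤ s {K} c {S} {W} s+c≤K S≤c+W = begin
  s ℤ.+ (+ S ℤ.- + W)                 ≤⟨ ZP.+-monoʳ-≤ s (ZP.+-monoˡ-≤ (ℤ.- + W) (+≤+ S≤c+W)) ⟩
  s ℤ.+ (+ (c ℕ.+ W) ℤ.- + W)         ≡⟨ cong (λ a → s ℤ.+ (a ℤ.- + W)) (ZP.pos-+ c W) ⟩
  s ℤ.+ (+ c ℤ.+ + W ℤ.- + W)         ≡⟨ cancel s (+ c) (+ W) ⟩
  s ℤ.+ + c                           ≤⟨ s+c≤K ⟩
  K                                   ∎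
  where
  open ZP.≤-Reasoning
  cancel : ∀ a b e → a ℤ.+ (b ℤ.+ e ℤ.- e) ≡ a ℤ.+ b
  cancel = ℤ-Solver.solve-∀

module _ (r : ℕ → ℕ) (r-increasing : ∀ k → r k < r (suc k)) (n d : ℕ)
         (σ : Config (suc d)) (σ-stable : Stable σ)
         (σ-boundary : ∀ k y → InB (r k) y → σ y ℤ.≤ + (2 ℕ.* suc d) ℤ.- + 2) where
  open Potential r
  open Radial (P n) (P-antitone n) {suc d}
  open PotentialLaplacian r r-increasing n d

  σ+0≤2d-1 : ∀ y → σ y ℤ.+ + 0 ℤ.≤ + (2 ℕ.* suc d) ℤ.- + 1
  σ+0≤2d-1 y = ZP.≤-trans (ZP.≤-reflexive (ZP.+-identityʳ (σ y))) (σ-stable y)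

  stabilises-at-origin : σ (origin (suc d)) ℤ.+ + n ℤ.+ Δ w (origin (suc d)) ℤ.≤ + (2 ℕ.* suc d) ℤ.- + 1
  stabilises-at-origin = begin
    σ o ℤ.+ + n ℤ.+ (+ S ℤ.- + W)       ≡⟨ regroup (σ o) (+ n) (+ S) (+ W) ⟩
    σ o ℤ.+ (+ S ℤ.+ + n ℤ.- + W)       ≡⟨ cong (λ a → σ o ℤ.+ (a ℤ.- + W)) (ZP.pos-+ S n) ⟨
    σ o ℤ.+ (+ (S ℕ.+ n) ℤ.- + W)       ≤⟨ +-difference-≤ (σ o) 0 (σ+0≤2d-1 o) laplacian-at-origin ⟩
    + (2 ℕ.* suc d) ℤ.- + 1             ∎
    where
    open ZP.≤-Reasoning
    o = origin (suc d)
    S = sum (map w (neighbours o))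
    W = 2 ℕ.* suc d ℕ.* w o
    regroup : ∀ a b c e → a ℤ.+ b ℤ.+ (c ℤ.- e) ≡ a ℤ.+ (c ℤ.+ b ℤ.- e)
    regroup = ℤ-Solver.solve-∀

  potential-stabilises : Stable (λ y → addAtOrigin σ n y ℤ.+ Δ w y)
  potential-stabilises y with y ≟S origin (suc d)
  ... | yes refl = stabilises-at-origin
  ... | no _ with laplacian-bound y
  ...   | inj₁ flat             = +-difference-≤ (σ y) 0 (σ+0≤2d-1 y) flat
  ...   | inj₂ (k , y∈B , kink) = +-difference-≤ (σ y) 1 σ+1≤2d-1 kink
    where
    drop-one : ∀ a → a ℤ.- + 2 ℤ.+ + 1 ≡ a ℤ.- + 1
    drop-one = ℤ-Solver.solve-∀
    σ+1≤2d-1 : σ y ℤ.+ + 1 ℤ.≤ + (2 ℕ.* suc d) ℤ.- + 1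
    σ+1≤2d-1 = ZP.≤-trans (ZP.+-monoˡ-≤ (+ 1) (σ-boundary k y y∈B))
                          (ZP.≤-reflexive (drop-one (+ (2 ℕ.* suc d))))

interval : ℕ → List ℤ
interval R = map +_ (upTo (suc R)) ++ map -[1+_] (upTo R)

∈-interval : ∀ {R} c → ∣ c ∣ ≤ R → c ∈ interval R
∈-interval {R} (+ k)    k≤R = ∈-++⁺ˡ (∈-map⁺ +_ (∈-upTo⁺ (s≤s k≤R)))
∈-interval {R} -[1+ k ] k<R = ∈-++⁺ʳ (map +_ (upTo (suc R))) (∈-map⁺ -[1+_] (∈-upTo⁺ k<R))

cube : (d R : ℕ) → List (Site d)
cube zero    R = [] ∷ []
cube (suc d) R = concatMap (λ c → map (c ∷_) (cube d R)) (interval R)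

∈-cube : ∀ {d R} (x : Site d) → InQ R x → x ∈ cube d R
∈-cube         []      []           = here refl
∈-cube {suc d} {R} (c ∷ x) (∣c∣≤R ∷ x∈Q) =
  ∈-concatMap⁺ (λ c → map (c ∷_) (cube d R)) (lose (∈-interval c ∣c∣≤R) (∈-map⁺ (c ∷_) (∈-cube x x∈Q)))

theorem4p2 : (d : ℕ) (e : Enumeration d) (r : ℕ → ℕ) →
    1 ℕ.≤ r 0 → (∀ k → r k ℕ.< r (suc k)) →
    (σ : Config d) → Stable σ →
    (∀ k y → InB (r k) y → σ y ℤ.≤ + (2 ℕ.* d) ℤ.- + 2) →
    Robust e σ
theorem4p2 zero    _ _ _ _            _ _        _          _ _ _ = cube 0 0 , λ { [] _ → here refl }
theorem4p2 (suc d) e r _ r-increasing σ σ-stable σ-boundary n _ R =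
  cube (suc d) (P n 0) , λ x x-topples →
    ∈-cube x (‖‖≤⇒InQ x (NP.<⇒≤ (0<P⇒<P0 n ‖ x ‖ (topples⇒0<w x-topples))))
  where
  open Potential r
  open Radial (P n) (P-antitone n) {suc d}
  open LeastAction R w (potential-stabilises r r-increasing n d σ σ-stable σ-boundary)
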